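{- Let $A$ be a list of $r$-coordinates sorted under a complete ordering $\tau$, let $\sigma$ be a complete ordering, and let $b(\tau,\sigma)$ be the number of indices $i\in\{1,\ldots,r\}$ with $f(\sigma,\sigma_i)\not\subseteq f(\tau,\sigma_i)$. Consider any sequence of exactly $b(\tau,\sigma)$ statements of the form $$A\gets\textsc{PartialSort}(A,(\psi_1,\ldots,\psi_l),\psi_k),$$ where $\psi$ is the complete ordering under which $A$ is sorted before that statement (starting with $\psi=\tau$ and, after each statement, replacing $\psi$ by $(\psi_1,\ldots,\psi_l,\psi_k,\psi_{l+1},\ldots,\psi_{k-1},\psi_{k+1},\ldots,\psi_r)$) and $k>l\ge0$. If this sequence reaches the ordering $\sigma$, then it contains no statement with $l=0$ for which there exists an index $i$ such that $f(\sigma,\sigma_i)\subseteq f(\tau,\sigma_i)$ and $\psi_k\in f(\sigma,\sigma_i)$.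
   Context: An $r$-coordinate is a tuple $(i_1,\ldots,i_r)$ of integers with $1\le i_m\le n_m$; position $m$ is mode $m$. A complete ordering is a tuple of all $r$ modes in some order (a permutation of $(1,\ldots,r)$). Coordinates are compared lexicographically under an ordering $\sigma$: $i<i'$ if $i_{\sigma_1}<i'_{\sigma_1}$, or $i_{\sigma_1}=i'_{\sigma_1}$ and $i<i'$ under $(\sigma_2,\ldots)$; all tuples are equal under $()$. A list is sorted under $\sigma$ if nondecreasing in this order. For $A$ sorted under a complete ordering $\psi$ and $0\le l<k\le r$, $\textsc{PartialSort}(A,(\psi_1,\ldots,\psi_l),\psi_k)$ returns the coordinates of $A$ rearranged to be sorted under $(\psi_1,\ldots,\psi_l,\psi_k,\psi_{l+1},\ldots,\psi_{k-1},\psi_{k+1},\ldots,\psi_r)$; a call with $l=0$ is non-bucketed, with $l\ge1$ bucketed. For a complete ordering $\tau$ and mode $p=\tau_k$, $f(\tau,p)=\{\tau_{k+1},\ldots,\tau_r\}$ is the set of modes following $p$ in $\tau$. -}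

module Defs where

open import Data.Nat using (ℕ; zero; suc; _∸_; _<_; _≤_)
open import Data.Fin using (Fin)
open import Data.Fin.Properties using () renaming (_≟_ to _≟F_)
open import Data.List using (List; []; _∷_; _++_; take; drop; length; filter; allFin)
open import Data.List.Membership.Propositional using (_∈_)
open import Data.List.Relation.Binary.Permutation.Propositional using (_↭_)
open import Data.Maybe using (Maybe; just; nothing)
open import Data.Product using (_×_; _,_)
open import Data.Unit using (⊤)
open import Data.Bool using (true; false)
open import Relation.Nullary using (¬_; ¬?; does)
open import Relation.Binary.PropositionalEquality using (_≡_)

-- Modes of an r-way tensor are Fin r (mode m ↦ index m-1).
Mode : ℕ → Set
Mode r = Fin r

Ordering : ℕ → Set
Ordering r = List (Mode r)

IsComplete : (r : ℕ) → Ordering r → Set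
IsComplete r ψ = ψ ↭ allFin r

-- 1-indexed access ψ_k (nothing if out of range).
at : {A : Set} → List A → ℕ → Maybe A
at []       _             = nothing
at (x ∷ xs) zero          = nothing
at (x ∷ xs) (suc zero)    = just x
at (x ∷ xs) (suc (suc k)) = at xs (suc k)

-- f(τ,p): the modes following p in τ (as a list).
follow : {r : ℕ} → Ordering r → Mode r → List (Mode r)
follow []       p = []
follow (x ∷ xs) p with does (x ≟F p)
... | true  = xs
... | false = follow xs p

open import Data.List.Relation.Binary.Subset.Propositional using (_⊆_) public

b : {r : ℕ} → Ordering r → Ordering r → ℕ
b {r} τ σ = length (filter (λ p → ¬? (follow σ p ⊆? follow τ p)) σ)
  where open import Data.List.Relation.Binary.Subset.DecPropositional (_≟F_ {r}) using (_⊆?_)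

-- The ordering after PartialSort(A,(ψ_1..ψ_l),ψ_k) (1-indexed l < k):
-- (ψ_1,…,ψ_l,ψ_k,ψ_{l+1},…,ψ_{k-1},ψ_{k+1},…,ψ_r).
move : {r : ℕ} → ℕ → ℕ → Ordering r → Ordering r
move l k ψ = take l ψ ++ take 1 (drop (k ∸ 1) ψ) ++ take (k ∸ 1 ∸ l) (drop l ψ) ++ drop k ψ

-- A statement A ← PartialSort(A,(ψ_1..ψ_l),ψ_k) is encoded by the pair (l , k).
Stmt : Set
Stmt = ℕ × ℕ

data Seq (r : ℕ) : Ordering r → List Stmt → Ordering r → Set where
  done : ∀ {ψ} → Seq r ψ [] ψ
  step : ∀ {ψ l k ss ψ'} → l < k → k ≤ r →
         Seq r (move l k ψ) ss ψ' → Seq r ψ ((l , k) ∷ ss) ψ'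

Forbidden : {r : ℕ} → Ordering r → Ordering r → Ordering r → Stmt → Set
Forbidden {r} τ σ ψ (l , k) =
  l ≡ 0 × (Σ (Mode r) λ p → p ∈ σ × follow σ p ⊆ follow τ p ×
            Σ (Mode r) λ q → at ψ k ≡ just q × q ∈ follow σ p)
  where open import Data.Product using (Σ)

NoForbidden : {r : ℕ} → Ordering r → Ordering r → Ordering r → List Stmt → Set
NoForbidden τ σ ψ []              = ⊤
NoForbidden τ σ ψ ((l , k) ∷ ss) = ¬ Forbidden τ σ ψ (l , k) × NoForbidden τ σ (move l k ψ) ss

-- A PartialSort step moves the mode q = ψ_k forward to position l+1. This can only
-- shrink f(ψ,p) for p ≠ q and only enlarge f(ψ,q), so b(ψ,σ) — the number of modes p
-- with f(σ,p) ⊄ f(ψ,p) — drops by at most one per step, and it is 0 at ψ = σ. A run of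
-- exactly b(τ,σ) steps reaching σ must therefore lower b at every step, so no step ever
-- breaks an inclusion f(σ,p) ⊆ f(ψ,p), and every mode with f(σ,p) ⊆ f(τ,p) keeps it.
-- A step with l = 0 puts q in front, so q ∉ f(ψ′,p) for all p ≠ q; it would break the
-- inclusion for any such p with q ∈ f(σ,p).
module Submission where

open import Defs
open import Data.Nat using (ℕ; zero; suc; _<_; _≤_; z≤n; s≤s)
open import Data.Nat.Properties using (≤-trans; ≤-reflexive; ≤-pred; m≤n⇒m≤1+n; <⇒≱)
open import Data.Fin using (Fin)
open import Data.Fin.Properties using () renaming (_≟_ to _≟F_)
open import Data.List using (List; []; _∷_; _++_; take; drop; length; filter)
open import Data.List.Properties using (filter-none; length-tabulate)
open import Data.List.Membership.Propositional using (_∈_; _∉_)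
open import Data.List.Membership.Propositional.Properties using (∈-++⁺ˡ; ∈-++⁺ʳ; ∈-allFin)
open import Data.List.Relation.Unary.Any using (here; there)
open import Data.List.Relation.Unary.All as All using ()
open import Data.List.Relation.Unary.All.Properties using (All¬⇒¬Any)
open import Data.List.Relation.Unary.AllPairs using (_∷_)
open import Data.List.Relation.Unary.Unique.Propositional using (Unique)
open import Data.List.Relation.Unary.Unique.Propositional.Properties using (allFin⁺)
open import Data.List.Relation.Binary.Permutation.Propositional using (↭-sym; ↭-trans; ↭⇒↭ₛ)
open import Data.List.Relation.Binary.Permutation.Propositional.Properties using (∈-resp-↭; ↭-length; ++⁺ˡ; shift)
open import Data.List.Relation.Binary.Subset.Propositional.Properties using (module ⊆-Reasoning; ⊆-refl; ⊆-reflexive; ⊆-reflexive-↭; ⊆-trans; ++⁺ʳ; xs⊆x∷xs; xs⊆ys++xs)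
open import Data.Maybe using (just)
open import Data.Product using (∃-syntax; _×_; _,_)
open import Data.Sum using (inj₁; inj₂)
open import Data.Unit using (tt)
open import Data.Empty using (⊥-elim)
open import Function using (_∘_)
open import Relation.Nullary using (¬_; ¬?; yes; no; contradiction)
open import Relation.Binary.Definitions using (DecidableEquality)
open import Relation.Unary using (Pred; Decidable; _∪_)
open import Relation.Unary.Properties using (_∪?_)
open import Relation.Binary.PropositionalEquality using (_≡_; _≢_; refl; sym; trans; cong; subst; setoid)

private
  variable
    r : ℕ

count : ∀ {a ℓ} {A : Set a} {P : Pred A ℓ} → Decidable P → List A → ℕ
count P? xs = length (filter P? xs)

module _ {a ℓ₁ ℓ₂} {A : Set a} {P : Pred A ℓ₁} {Q : Pred A ℓ₂} (P? : Decidable P) (Q? : Decidable Q) where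

  count-mono : ∀ {xs} → (∀ {x} → x ∈ xs → P x → Q x) → count P? xs ≤ count Q? xs
  count-mono {[]}     _   = z≤n
  count-mono {x ∷ xs} P⇒Q with P? x | Q? x
  ... | yes _  | yes _  = s≤s (count-mono (P⇒Q ∘ there))
  ... | yes px | no ¬qx = contradiction (P⇒Q (here refl) px) ¬qx
  ... | no _   | yes _  = m≤n⇒m≤1+n (count-mono (P⇒Q ∘ there))
  ... | no _   | no _   = count-mono (P⇒Q ∘ there)

  count-mono-< : ∀ {xs y} → (∀ {x} → x ∈ xs → P x → Q x) →
                 y ∈ xs → ¬ P y → Q y → count P? xs < count Q? xs
  count-mono-< {x ∷ xs} P⇒Q (here refl) ¬py qy with P? x | Q? x
  ... | yes py | _      = contradiction py ¬py
  ... | no _   | yes _  = s≤s (count-mono (P⇒Q ∘ there))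
  ... | no _   | no ¬qy = contradiction qy ¬qy
  count-mono-< {x ∷ xs} P⇒Q (there y∈xs) ¬py qy with P? x | Q? x
  ... | yes _  | yes _  = s≤s (count-mono-< (P⇒Q ∘ there) y∈xs ¬py qy)
  ... | yes px | no ¬qx = contradiction (P⇒Q (here refl) px) ¬qx
  ... | no _   | yes _  = m≤n⇒m≤1+n (count-mono-< (P⇒Q ∘ there) y∈xs ¬py qy)
  ... | no _   | no _   = count-mono-< (P⇒Q ∘ there) y∈xs ¬py qy

module _ {a} {A : Set a} (_≟_ : DecidableEquality A) {ℓ} {P : Pred A ℓ} (P? : Decidable P) (z : A) where

  count-∪-≡-∉ : ∀ {xs} → z ∉ xs → count (P? ∪? (_≟ z)) xs ≤ count P? xs
  count-∪-≡-∉ z∉xs = count-mono (P? ∪? (_≟ z)) P? λ where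
    _    (inj₁ px)   → px
    x∈xs (inj₂ refl) → ⊥-elim (z∉xs x∈xs)

  count-∪-≡ : ∀ {xs} → Unique xs → count (P? ∪? (_≟ z)) xs ≤ suc (count P? xs)
  count-∪-≡ {[]}     _            = z≤n
  count-∪-≡ {x ∷ xs} (x∉xs ∷ uxs) with x ≟ z | P? x
  ... | yes refl | yes _ = s≤s (m≤n⇒m≤1+n (count-∪-≡-∉ (All¬⇒¬Any x∉xs)))
  ... | yes refl | no _  = s≤s (count-∪-≡-∉ (All¬⇒¬Any x∉xs))
  ... | no _     | yes _ = s≤s (count-∪-≡ uxs)
  ... | no _     | no _  = count-∪-≡ uxs

follow-here : (p : Fin r) (xs : List (Fin r)) → follow (p ∷ xs) p ≡ xs
follow-here p xs with p ≟F p
... | yes _   = refl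
... | no p≢p = contradiction refl p≢p

follow-there : {a p : Fin r} (xs : List (Fin r)) → a ≢ p → follow (a ∷ xs) p ≡ follow xs p
follow-there {a = a} {p = p} xs a≢p with a ≟F p
... | yes a≡p = contradiction a≡p a≢p
... | no _    = refl

follow-⊆ : (xs : List (Fin r)) (p : Fin r) → follow xs p ⊆ xs
follow-⊆ []       p ()
follow-⊆ (a ∷ xs) p with a ≟F p
... | yes _ = there
... | no _  = there ∘ follow-⊆ xs p

follow-++-∉ : (xs : List (Fin r)) {ys : List (Fin r)} {p : Fin r} → p ∉ xs →
              follow (xs ++ ys) p ≡ follow ys p
follow-++-∉ []       _    = refl
follow-++-∉ (x ∷ xs) p∉xs =
  trans (follow-there (xs ++ _) (p∉xs ∘ here ∘ sym)) (follow-++-∉ xs (p∉xs ∘ there))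

∉-follow-self : {xs : List (Fin r)} → Unique xs → (p : Fin r) → p ∉ follow xs p
∉-follow-self {xs = a ∷ xs} (a∉xs ∷ uxs) p with a ≟F p
... | yes refl = All¬⇒¬Any a∉xs
... | no _     = ∉-follow-self uxs p

∉-follow-++-∷ : (A : List (Fin r)) {E : List (Fin r)} {q p : Fin r} → q ∉ E → p ∉ A → p ≢ q →
                q ∉ follow (A ++ q ∷ E) p
∉-follow-++-∷ A {E} {q} {p} q∉E p∉A p≢q =
  q∉E ∘ follow-⊆ E p ∘ subst (q ∈_) (trans (follow-++-∉ A p∉A) (follow-there E (p≢q ∘ sym)))

follow-insert : (xs ys : List (Fin r)) {y p : Fin r} → y ≢ p →
                follow (xs ++ ys) p ⊆ follow (xs ++ y ∷ ys) p
follow-insert []       ys y≢p = ⊆-reflexive (sym (follow-there ys y≢p))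
follow-insert (x ∷ xs) ys {y} {p} y≢p with x ≟F p
... | yes _ = ++⁺ʳ xs (xs⊆x∷xs ys y)
... | no _  = follow-insert xs ys y≢p

follow-moveForward-⊆ : (A B D : List (Fin r)) {q p : Fin r} → q ≢ p →
                       follow (A ++ q ∷ B ++ D) p ⊆ follow (A ++ B ++ q ∷ D) p
follow-moveForward-⊆ []      B D q≢p = ⊆-trans (⊆-reflexive (follow-there (B ++ D) q≢p)) (follow-insert B D q≢p)
follow-moveForward-⊆ (a ∷ A) B D {q} {p} q≢p with a ≟F p
... | yes _ = ⊆-reflexive-↭ (++⁺ˡ A (↭-sym (shift q B D)))
... | no _  = follow-moveForward-⊆ A B D q≢p

follow-moveForward-self : (A B D : List (Fin r)) {q : Fin r} → q ∉ A → q ∉ B →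
                          follow (A ++ B ++ q ∷ D) q ⊆ follow (A ++ q ∷ B ++ D) q
follow-moveForward-self {r} A B D {q} q∉A q∉B = begin
  follow (A ++ B ++ q ∷ D) q  ≡⟨ follow-++-∉ A q∉A ⟩
  follow (B ++ q ∷ D) q       ≡⟨ follow-++-∉ B q∉B ⟩
  follow (q ∷ D) q            ≡⟨ follow-here q D ⟩
  D                           ⊆⟨ xs⊆ys++xs D B ⟩
  B ++ D                      ≡⟨ follow-here q (B ++ D) ⟨
  follow (q ∷ B ++ D) q       ≡⟨ follow-++-∉ A q∉A ⟨
  follow (A ++ q ∷ B ++ D) q  ∎
  where open ⊆-Reasoning (Fin r)

split-at : ∀ i (ψ : List (Fin r)) → i < length ψ →
  ∃[ B ] ∃[ q ] ∃[ D ] ψ ≡ B ++ q ∷ D × take i ψ ≡ B × drop i ψ ≡ q ∷ D ×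
                       drop (suc i) ψ ≡ D × at ψ (suc i) ≡ just q
split-at zero    (x ∷ ψ) _         = [] , x , ψ , refl , refl , refl , refl , refl
split-at (suc i) (x ∷ ψ) (s≤s i<) with B , q , D , ψ≡ , tk , dr , dr′ , at≡ ← split-at i ψ i< =
  x ∷ B , q , D , cong (x ∷_) ψ≡ , cong (x ∷_) tk , dr , dr′ , at≡

move-split : ∀ l k (ψ : List (Fin r)) → l < k → k ≤ length ψ →
  ∃[ A ] ∃[ B ] ∃[ q ] ∃[ D ] ψ ≡ A ++ B ++ q ∷ D × move l k ψ ≡ A ++ q ∷ B ++ D ×
                              at ψ k ≡ just q × take l ψ ≡ A
move-split zero (suc i) ψ _ k≤
  with B , q , D , ψ≡ , tk , dr , dr′ , at≡ ← split-at i ψ k≤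
  rewrite tk | dr | dr′ = [] , B , q , D , ψ≡ , refl , at≡ , refl
move-split (suc l) (suc (suc i)) (x ∷ ψ) (s≤s l<k) (s≤s k≤)
  with A , B , q , D , ψ≡ , mv≡ , at≡ , tk ← move-split l (suc i) ψ l<k k≤ =
  x ∷ A , B , q , D , cong (x ∷_) ψ≡ , cong (x ∷_) mv≡ , at≡ , cong (x ∷_) tk

unique-complete : {ψ : Ordering r} → IsComplete r ψ → Unique ψ
unique-complete {r} ψ↭ = Unique-resp-↭ (↭⇒↭ₛ (↭-sym ψ↭)) (allFin⁺ r)
  where open import Data.List.Relation.Binary.Permutation.Setoid.Properties (setoid (Fin r)) using (Unique-resp-↭)

length-complete : {ψ : Ordering r} → IsComplete r ψ → length ψ ≡ r
length-complete {r} ψ↭ = trans (↭-length ψ↭) (length-tabulate (λ i → i))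

record MoveEffect (l k : ℕ) (ψ ψ′ : Ordering r) : Set where
  field
    moved          : Mode r
    at-moved       : at ψ k ≡ just moved
    complete       : IsComplete r ψ′
    others-shrink  : ∀ {p} → p ≢ moved → follow ψ′ p ⊆ follow ψ p
    moved-grows    : follow ψ moved ⊆ follow ψ′ moved
    front-excludes : ∀ {p} → p ∉ take l ψ → p ≢ moved → moved ∉ follow ψ′ p

move-effect : ∀ {ψ : Ordering r} {l k} → IsComplete r ψ → l < k → k ≤ r → MoveEffect l k ψ (move l k ψ)
move-effect {r} {ψ} {l} {k} ψ↭ l<k k≤r
  with A , B , q , D , refl , mv≡ , at≡ , tk ← move-split l k ψ l<k (subst (k ≤_) (sym (length-complete ψ↭)) k≤r)
  = subst (MoveEffect l k ψ) (sym mv≡) record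
    { moved          = q
    ; at-moved       = at≡
    ; complete       = ψ′↭
    ; others-shrink  = λ p≢q → follow-moveForward-⊆ A B D (p≢q ∘ sym)
    ; moved-grows    = follow-moveForward-self A B D (q-fresh ∘ ∈-++⁺ˡ) (q-fresh ∘ ∈-++⁺ʳ A ∘ ∈-++⁺ˡ)
    ; front-excludes = λ p∉ → ∉-follow-++-∷ A (q-fresh ∘ ∈-++⁺ʳ A) (subst (_ ∉_) tk p∉)
    }
  where
    ψ′↭ : IsComplete r (A ++ q ∷ B ++ D)
    ψ′↭ = ↭-trans (++⁺ˡ A (↭-sym (shift q B D))) ψ↭
    q-fresh : q ∉ A ++ B ++ D
    q-fresh with q∉ ∷ _ ← unique-complete (↭-trans (↭-sym (shift q A (B ++ D))) ψ′↭) = All¬⇒¬Any q∉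

module _ {r : ℕ} (σ : Ordering r) (σ↭ : IsComplete r σ) where
  open import Data.List.Relation.Binary.Subset.DecPropositional (_≟F_ {r}) using (_⊆?_)

  Good : Ordering r → Mode r → Set
  Good ψ p = follow σ p ⊆ follow ψ p

  Good? : (ψ : Ordering r) → Decidable (Good ψ)
  Good? ψ p = follow σ p ⊆? follow ψ p

  Bad? : (ψ : Ordering r) → Decidable (λ p → ¬ Good ψ p)
  Bad? ψ p = ¬? (Good? ψ p)

  b-self : b σ σ ≡ 0
  b-self = cong length (filter-none (Bad? σ) {σ} (All.tabulate λ _ bad → bad ⊆-refl))

  module _ {l k} {ψ ψ′ : Ordering r} (M : MoveEffect l k ψ ψ′) where
    open MoveEffect M

    bad-stays-bad : ∀ {p} → p ∈ σ → ¬ Good ψ p → ((λ x → ¬ Good ψ′ x) ∪ (_≡ moved)) p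
    bad-stays-bad {p} _ bad with p ≟F moved
    ... | yes p≡q = inj₂ p≡q
    ... | no p≢q  = inj₁ λ good → bad (⊆-trans good (others-shrink p≢q))

    b-move-≤ : b ψ σ ≤ suc (b ψ′ σ)
    b-move-≤ = ≤-trans (count-mono (Bad? ψ) (Bad? ψ′ ∪? (_≟F moved)) bad-stays-bad)
                       (count-∪-≡ _≟F_ (Bad? ψ′) moved (unique-complete σ↭))

    b-move-≥ : ∀ {p} → Good ψ p → ¬ Good ψ′ p → b ψ σ ≤ b ψ′ σ
    b-move-≥ {p} good bad′ = ≤-pred (≤-trans
      (count-mono-< (Bad? ψ) (Bad? ψ′ ∪? (_≟F moved)) bad-stays-bad
                    (∈-resp-↭ (↭-sym σ↭) (∈-allFin p)) (λ bad → bad good) (inj₁ bad′))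
      (count-∪-≡ _≟F_ (Bad? ψ′) moved (unique-complete σ↭)))

    good-stays-good : b ψ′ σ < b ψ σ → ∀ {p} → Good ψ p → Good ψ′ p
    good-stays-good decreases {p} good with p ≟F moved | Good? ψ′ p
    ... | yes refl | _         = ⊆-trans good moved-grows
    ... | no _     | yes good′ = good′
    ... | no _     | no bad′   = contradiction (b-move-≥ good bad′) (<⇒≱ decreases)

  b≤length : ∀ {ψ ss} → IsComplete r ψ → Seq r ψ ss σ → b ψ σ ≤ length ss
  b≤length _  done              = ≤-reflexive b-self
  b≤length ψ↭ (step l<k k≤r sq) = ≤-trans (b-move-≤ M) (s≤s (b≤length (MoveEffect.complete M) sq))
    where M = move-effect ψ↭ l<k k≤r

  noForbidden-tight : (τ : Ordering r) {ψ : Ordering r} {ss : List Stmt} →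
    IsComplete r ψ → Seq r ψ ss σ → length ss ≤ b ψ σ → (∀ {p} → Good τ p → Good ψ p) →
    NoForbidden τ σ ψ ss
  noForbidden-tight τ _ done _ _ = tt
  noForbidden-tight τ {ψ} ψ↭ (step {l = l} {k} {ss} l<k k≤r sq) tight τ⇒ψ =
    not-forbidden , noForbidden-tight τ complete sq tight′ (good-stays-good M decreases ∘ τ⇒ψ)
    where
      M = move-effect ψ↭ l<k k≤r
      open MoveEffect M

      decreases : b (move l k ψ) σ < b ψ σ
      decreases = ≤-trans (s≤s (b≤length complete sq)) tight

      tight′ : length ss ≤ b (move l k ψ) σ
      tight′ = ≤-pred (≤-trans tight (b-move-≤ M))

      not-forbidden : ¬ Forbidden τ σ ψ (l , k)
      not-forbidden (l≡0 , p , _ , goodτ , q , at-q , q∈) with refl ← trans (sym at-moved) at-q =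
        front-excludes p∉front p≢q (good-stays-good M decreases (τ⇒ψ goodτ) q∈)
        where
          p∉front : p ∉ take l ψ
          p∉front = subst (λ n → p ∉ take n ψ) (sym l≡0) λ ()
          p≢q : p ≢ q
          p≢q refl = ∉-follow-self (unique-complete σ↭) p q∈

lemma3p3 : (r : ℕ) (τ σ : Ordering r) → IsComplete r τ → IsComplete r σ →
    (ss : List Stmt) → length ss ≡ b τ σ → Seq r τ ss σ →
    NoForbidden τ σ τ ss
lemma3p3 r τ σ τ↭ σ↭ ss len≡b run = noForbidden-tight σ σ↭ τ τ↭ run (≤-reflexive len≡b) (λ good → good)
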